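{- Let $G,H$ be abelian groups and let $\alpha:1\to1$ be a phase of either colour in the $\dagger$-PROP $\mathbf{IF}(G,H)$. Then $\alpha$ is a bialgebra morphism for $(\delta_g,\epsilon_g,\mu_r,\eta_r)$ if and only if $\alpha=\mathrm{id}_1$.
   Context: A $\dagger$-PROP is a strict symmetric monoidal category with objects $\mathbb{N}$ (tensor $=$ addition) with an identity-on-objects involutive contravariant functor $\dagger$ compatible with $\otimes$ and the symmetry $\sigma$. For an abelian group $G$, $\mathbf{F}G$ is the $\dagger$-PROP generated by $\mu:2\to1$, $\eta:0\to1$ and $g:1\to1$ ($g\in G$), with $\delta:=\mu^\dagger$, $\epsilon:=\eta^\dagger$, $g^\dagger=g^{ -1}$, subject to: $(\mu,\eta)$ commutative monoid, $(\mu\otimes\mathrm{id}_1)(\mathrm{id}_1\otimes\delta)=\delta\mu=(\mathrm{id}_1\otimes\mu)(\delta\otimes\mathrm{id}_1)$, $\mu\delta=\mathrm{id}_1$, $g\circ g'=gg'$, $e=\mathrm{id}_1$, $g\circ\mu=\mu\circ(g\otimes\mathrm{id}_1)$, $\delta\circ g=(g\otimes\mathrm{id}_1)\circ\delta$. $\mathbf{IF}(G,H)$ is the quotient of the coproduct $\mathbf{F}G+\mathbf{F}H$ (green generators $\mu_g,\eta_g,\dots$ from $\mathbf{F}G$, red $\mu_r,\eta_r,\dots$ from $\mathbf{F}H$) by the bialgebra laws $\delta_g\mu_r=(\mu_r\otimes\mu_r)(\mathrm{id}_1\otimes\sigma\otimes\mathrm{id}_1)(\delta_g\otimes\delta_g)$,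 $\delta_g\eta_r=\eta_r\otimes\eta_r$, $\epsilon_g\mu_r=\epsilon_g\otimes\epsilon_g$ (scalar factors built from $\epsilon_g\eta_r$ suppressed by convention) and $\eta_r=(\epsilon_r\otimes\mathrm{id}_1)\delta_g\eta_g$, $\epsilon_g=\epsilon_r\mu_r(\mathrm{id}_1\otimes\eta_g)$. A phase of colour $c\in\{g,r\}$ is a unitary $\alpha:1\to1$ ($\alpha^\dagger\alpha=\alpha\alpha^\dagger=\mathrm{id}_1$) with $\mu_c\circ(\alpha\otimes\mathrm{id}_1)=\alpha\circ\mu_c$. A bialgebra morphism for $(\delta_g,\epsilon_g,\mu_r,\eta_r)$ is $f:1\to1$ with $f\mu_r=\mu_r(f\otimes f)$, $f\eta_r=\eta_r$, $\delta_g f=(f\otimes f)\delta_g$, $\epsilon_g f=\epsilon_g$. -}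

module Defs where

open import Level using (Level; _⊔_)
open import Data.Nat using (ℕ; _+_)
open import Data.Nat.Properties using (+-assoc; +-identityʳ)
open import Relation.Binary.PropositionalEquality using (_≡_; refl; sym)
open import Data.Product using (_×_)
open import Algebra.Bundles using (AbelianGroup)

-- The two colours of IF(G,H): green (from F G) and red (from F H).
data Colour : Set where
  green red : Colour

module _ {a ℓa b ℓb : Level} (G : AbelianGroup a ℓa) (H : AbelianGroup b ℓb) where

  private
    module G = AbelianGroup G
    module H = AbelianGroup H

  infixr 9 _∘_
  infixl 8 _⊗_

  -- Syntax (string diagrams) of the †-PROP freely generated by the
  -- generators of F G + F H, together with their daggers.
  data Term : ℕ → ℕ → Set (a ⊔ b) where
    id    : (n : ℕ) → Term n n
    _∘_   : {m n p : ℕ} → Term n p → Term m n → Term m p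
    _⊗_   : {m n m' n' : ℕ} → Term m n → Term m' n' → Term (m + m') (n + n')
    σ     : (m n : ℕ) → Term (m + n) (n + m)
    μ     : Colour → Term 2 1
    η     : Colour → Term 0 1
    δ     : Colour → Term 1 2
    ε     : Colour → Term 1 0
    phG   : G.Carrier → Term 1 1
    phH   : H.Carrier → Term 1 1

  _† : {m n : ℕ} → Term m n → Term n m
  id n † = id n
  (f ∘ g) † = (g †) ∘ (f †)
  (f ⊗ g) † = (f †) ⊗ (g †)
  σ m n † = σ n m
  μ c † = δ c
  η c † = ε c
  δ c † = μ c
  ε c † = η c
  phG x † = phG (x G.⁻¹)
  phH x † = phH (x H.⁻¹)

  -- transport along equalities of arities (needed for strictness axioms)
  cast : {m n m' n' : ℕ} → m ≡ m' → n ≡ n' → Term m n → Term m' n'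
  cast refl refl f = f

  infix 4 _≈_

  -- The congruence presenting IF(G,H): strict symmetric monoidal
  -- category axioms, F G and F H axioms, and the bialgebra laws.
  -- Closure under † makes the dagger well defined on the quotient.
  data _≈_ : {m n : ℕ} → Term m n → Term m n → Set (a ⊔ b ⊔ ℓa ⊔ ℓb) where
    ≈-refl  : ∀ {m n} {f : Term m n} → f ≈ f
    ≈-sym   : ∀ {m n} {f g : Term m n} → f ≈ g → g ≈ f
    ≈-trans : ∀ {m n} {f g h : Term m n} → f ≈ g → g ≈ h → f ≈ h
    ∘-cong  : ∀ {m n p} {f f' : Term n p} {g g' : Term m n} →
              f ≈ f' → g ≈ g' → f ∘ g ≈ f' ∘ g'
    ⊗-cong  : ∀ {m n m' n'} {f f' : Term m n} {g g' : Term m' n'} →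
              f ≈ f' → g ≈ g' → f ⊗ g ≈ f' ⊗ g'
    †-cong  : ∀ {m n} {f g : Term m n} → f ≈ g → (f †) ≈ (g †)
    phG-cong : ∀ {x y} → x G.≈ y → phG x ≈ phG y
    phH-cong : ∀ {x y} → x H.≈ y → phH x ≈ phH y
    idˡ     : ∀ {m n} {f : Term m n} → id n ∘ f ≈ f
    idʳ     : ∀ {m n} {f : Term m n} → f ∘ id m ≈ f
    ∘-assoc : ∀ {m n p q} {f : Term p q} {g : Term n p} {h : Term m n} →
              (f ∘ g) ∘ h ≈ f ∘ (g ∘ h)
    ⊗-id    : ∀ {m n} → id m ⊗ id n ≈ id (m + n)
    interchange : ∀ {m n p m' n' p'} {f : Term n p} {g : Term m n}
                    {f' : Term n' p'} {g' : Term m' n'} →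
                  (f ∘ g) ⊗ (f' ∘ g') ≈ (f ⊗ f') ∘ (g ⊗ g')
    ⊗-unitˡ : ∀ {m n} {f : Term m n} → id 0 ⊗ f ≈ f
    ⊗-unitʳ : ∀ {m n} {f : Term m n} →
              f ⊗ id 0 ≈ cast (sym (+-identityʳ m)) (sym (+-identityʳ n)) f
    ⊗-assoc : ∀ {m n m' n' m'' n''} {f : Term m n} {g : Term m' n'}
                {h : Term m'' n''} →
              (f ⊗ g) ⊗ h ≈ cast (sym (+-assoc m m' m'')) (sym (+-assoc n n' n''))
                                 (f ⊗ (g ⊗ h))
    σ-inv   : ∀ {m n} → σ n m ∘ σ m n ≈ id (m + n)
    σ-nat   : ∀ {m n m' n'} {f : Term m m'} {g : Term n n'} →
              σ m' n' ∘ (f ⊗ g) ≈ (g ⊗ f) ∘ σ m n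
    σ-unit  : ∀ {n} → σ 0 n ≈ cast refl (sym (+-identityʳ n)) (id n)
    σ-hex   : ∀ {m n p} →
              σ m (n + p) ≈
                cast (+-assoc m n p) (sym (+-assoc n p m))
                  ((id n ⊗ σ m p) ∘ cast refl (+-assoc n m p) (σ m n ⊗ id p))
    μ-assoc : ∀ {c} → μ c ∘ (μ c ⊗ id 1) ≈ μ c ∘ (id 1 ⊗ μ c)
    μ-unit  : ∀ {c} → μ c ∘ (η c ⊗ id 1) ≈ id 1
    μ-comm  : ∀ {c} → μ c ∘ σ 1 1 ≈ μ c
    frob₁   : ∀ {c} → (μ c ⊗ id 1) ∘ (id 1 ⊗ δ c) ≈ δ c ∘ μ c
    frob₂   : ∀ {c} → δ c ∘ μ c ≈ (id 1 ⊗ μ c) ∘ (δ c ⊗ id 1)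
    special : ∀ {c} → μ c ∘ δ c ≈ id 1
    phG-mul  : ∀ {x y} → phG x ∘ phG y ≈ phG (x G.∙ y)
    phG-e    : phG G.ε ≈ id 1
    phG-μ    : ∀ {x} → phG x ∘ μ green ≈ μ green ∘ (phG x ⊗ id 1)
    phG-δ    : ∀ {x} → δ green ∘ phG x ≈ (phG x ⊗ id 1) ∘ δ green
    phH-mul  : ∀ {x y} → phH x ∘ phH y ≈ phH (x H.∙ y)
    phH-e    : phH H.ε ≈ id 1
    phH-μ    : ∀ {x} → phH x ∘ μ red ≈ μ red ∘ (phH x ⊗ id 1)
    phH-δ    : ∀ {x} → δ red ∘ phH x ≈ (phH x ⊗ id 1) ∘ δ red
    -- bialgebra laws of IF(G,H) (scalars suppressed)
    bialg    : δ green ∘ μ red ≈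
               (μ red ⊗ μ red) ∘ (id 1 ⊗ σ 1 1 ⊗ id 1) ∘ (δ green ⊗ δ green)
    copy     : δ green ∘ η red ≈ η red ⊗ η red
    cocopy   : ε green ∘ μ red ≈ ε green ⊗ ε green
    η-red    : η red ≈ (ε red ⊗ id 1) ∘ δ green ∘ η green
    ε-green  : ε green ≈ ε red ∘ μ red ∘ (id 1 ⊗ η green)

  IsPhase : Colour → Term 1 1 → Set (a ⊔ b ⊔ ℓa ⊔ ℓb)
  IsPhase c α = ((α †) ∘ α ≈ id 1) × (α ∘ (α †) ≈ id 1)
                × (μ c ∘ (α ⊗ id 1) ≈ α ∘ μ c)

  IsBialgMorph : Term 1 1 → Set (a ⊔ b ⊔ ℓa ⊔ ℓb)
  IsBialgMorph f = (f ∘ μ red ≈ μ red ∘ (f ⊗ f)) × (f ∘ η red ≈ η red)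
                   × (δ green ∘ f ≈ (f ⊗ f) ∘ δ green) × (ε green ∘ f ≈ ε green)

module Submission where

-- Let μ, η be the monoid of colour c.  If α commutes with
-- μ in its first argument (a phase, μ(α⊗1) = αμ) and also distributes over it
-- (a monoid morphism, αμ = μ(α⊗α)), then μ(α⊗1) = μ(α⊗α); precomposing with
-- η⊗1 and using αη = η gives 1 = μ(η⊗1) = μ(η⊗α) = α  ("unit cancellation").
--   * For a red phase this applies directly to (μ_r, η_r).
--   * For a green phase we apply it to α† and (μ_g, η_g): the adjoint of a
--     unitary phase is again a phase, and the dagger turns the coalgebra-morphism
--     laws δ_g α = (α⊗α)δ_g, ε_g α = ε_g into α†μ_g = μ_g(α†⊗α†), α†η_g = η_g.
--     From α† = 1 unitarity gives α = α α† = 1.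
-- Conversely the identity is a bialgebra morphism, and the laws are stable
-- under replacing α by anything equal to the identity.

open import Defs
open import Algebra.Bundles using (AbelianGroup)
open import Function.Bundles using (_⇔_; mk⇔)
open import Data.Nat using (ℕ)
open import Data.Product using (_,_)
open import Relation.Binary.Bundles using (Setoid)
import Relation.Binary.Reasoning.Setoid as SetoidReasoning

module Proof {a ℓa b ℓb} (G : AbelianGroup a ℓa) (H : AbelianGroup b ℓb) where

  private
    T : ℕ → ℕ → Set _
    T = Term G H

    infix 4 _≋_
    _≋_ : ∀ {m n} → T m n → T m n → Set _
    _≋_ = _≈_ G H

    adj : ∀ {m n} → T m n → T n m
    adj = _† G H

  homSetoid : ℕ → ℕ → Setoid _ _
  homSetoid m n = record
    { Carrier       = T m n
    ; _≈_           = _≋_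
    ; isEquivalence = record { refl = ≈-refl ; sym = ≈-sym ; trans = ≈-trans }
    }

  module ≈-Reasoning {m n : ℕ} = SetoidReasoning (homSetoid m n)
  open ≈-Reasoning

  state⊗ : (f : T 0 1) (g : T 1 1) → f ⊗ g ≋ (f ⊗ id 1) ∘ g
  state⊗ f g = begin
    f ⊗ g                      ≈⟨ ⊗-cong (≈-sym idʳ) (≈-sym idˡ) ⟩
    (f ∘ id 0) ⊗ (id 1 ∘ g)    ≈⟨ interchange ⟩
    (f ⊗ id 1) ∘ (id 0 ⊗ g)    ≈⟨ ∘-cong ≈-refl ⊗-unitˡ ⟩
    (f ⊗ id 1) ∘ g             ∎

  unit-absorbs : (c : Colour) (f : T 1 1) → μ c ∘ (η c ⊗ f) ≋ f
  unit-absorbs c f = begin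
    μ c ∘ (η c ⊗ f)                  ≈⟨ ∘-cong ≈-refl (state⊗ (η c) f) ⟩
    μ c ∘ ((η c ⊗ id 1) ∘ f)         ≈⟨ ≈-sym ∘-assoc ⟩
    (μ c ∘ (η c ⊗ id 1)) ∘ f         ≈⟨ ∘-cong μ-unit ≈-refl ⟩
    id 1 ∘ f                         ≈⟨ idˡ ⟩
    f                                ∎

  unit-cancel : (c : Colour) (α : T 1 1) →
                μ c ∘ (α ⊗ id 1) ≋ μ c ∘ (α ⊗ α) → α ∘ η c ≋ η c → α ≋ id 1
  unit-cancel c α split fix = begin
    α                                  ≈⟨ ≈-sym (unit-absorbs c α) ⟩
    μ c ∘ (η c ⊗ α)                    ≈⟨ ∘-cong ≈-refl (⊗-cong (≈-sym fix) (≈-sym idʳ)) ⟩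
    μ c ∘ ((α ∘ η c) ⊗ (α ∘ id 1))     ≈⟨ ∘-cong ≈-refl interchange ⟩
    μ c ∘ ((α ⊗ α) ∘ (η c ⊗ id 1))     ≈⟨ ≈-sym ∘-assoc ⟩
    (μ c ∘ (α ⊗ α)) ∘ (η c ⊗ id 1)     ≈⟨ ∘-cong (≈-sym split) ≈-refl ⟩
    (μ c ∘ (α ⊗ id 1)) ∘ (η c ⊗ id 1)  ≈⟨ ∘-assoc ⟩
    μ c ∘ ((α ⊗ id 1) ∘ (η c ⊗ id 1))  ≈⟨ ∘-cong ≈-refl (≈-sym interchange) ⟩
    μ c ∘ ((α ∘ η c) ⊗ (id 1 ∘ id 1))  ≈⟨ ∘-cong ≈-refl (⊗-cong fix idˡ) ⟩
    μ c ∘ (η c ⊗ id 1)                 ≈⟨ μ-unit ⟩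
    id 1                               ∎

  whisker-inverse : (f g : T 1 1) → f ∘ g ≋ id 1 → (f ⊗ id 1) ∘ (g ⊗ id 1) ≋ id 2
  whisker-inverse f g fg = begin
    (f ⊗ id 1) ∘ (g ⊗ id 1)    ≈⟨ ≈-sym interchange ⟩
    (f ∘ g) ⊗ (id 1 ∘ id 1)    ≈⟨ ⊗-cong fg idˡ ⟩
    id 1 ⊗ id 1                ≈⟨ ⊗-id ⟩
    id 2                       ∎

  -- The adjoint of a unitary phase of colour c is again a phase of colour c:
  -- α†μ = α†μ(α⊗1)(α†⊗1) = α†αμ(α†⊗1) = μ(α†⊗1).
  adjoint-phase : (c : Colour) (α : T 1 1) → adj α ∘ α ≋ id 1 → α ∘ adj α ≋ id 1 →
                  μ c ∘ (α ⊗ id 1) ≋ α ∘ μ c → μ c ∘ (adj α ⊗ id 1) ≋ adj α ∘ μ c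
  adjoint-phase c α α†α αα† phase = ≈-sym (begin
    α† ∘ μ c                                     ≈⟨ ≈-sym idʳ ⟩
    (α† ∘ μ c) ∘ id 2                            ≈⟨ ∘-cong ≈-refl (≈-sym (whisker-inverse α α† αα†)) ⟩
    (α† ∘ μ c) ∘ ((α ⊗ id 1) ∘ (α† ⊗ id 1))      ≈⟨ ∘-assoc ⟩
    α† ∘ (μ c ∘ ((α ⊗ id 1) ∘ (α† ⊗ id 1)))      ≈⟨ ∘-cong ≈-refl (≈-sym ∘-assoc) ⟩
    α† ∘ ((μ c ∘ (α ⊗ id 1)) ∘ (α† ⊗ id 1))      ≈⟨ ∘-cong ≈-refl (∘-cong phase ≈-refl) ⟩
    α† ∘ ((α ∘ μ c) ∘ (α† ⊗ id 1))               ≈⟨ ∘-cong ≈-refl ∘-assoc ⟩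
    α† ∘ (α ∘ (μ c ∘ (α† ⊗ id 1)))               ≈⟨ ≈-sym ∘-assoc ⟩
    (α† ∘ α) ∘ (μ c ∘ (α† ⊗ id 1))               ≈⟨ ∘-cong α†α ≈-refl ⟩
    id 1 ∘ (μ c ∘ (α† ⊗ id 1))                   ≈⟨ idˡ ⟩
    μ c ∘ (α† ⊗ id 1)                            ∎)
    where α† = adj α

  morphism⇒id : (c : Colour) (α : T 1 1) → IsPhase G H c α → IsBialgMorph G H α → α ≋ id 1
  morphism⇒id red α (_ , _ , phase) (μ-morph , η-morph , _ , _) =
    unit-cancel red α (≈-trans phase μ-morph) η-morph
  morphism⇒id green α (α†α , αα† , phase) (_ , _ , δ-morph , ε-morph) = begin
    α            ≈⟨ ≈-sym idʳ ⟩
    α ∘ id 1     ≈⟨ ∘-cong ≈-refl (≈-sym α†≈id) ⟩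
    α ∘ adj α    ≈⟨ αα† ⟩
    id 1         ∎
    where
    α†≈id : adj α ≋ id 1
    α†≈id = unit-cancel green (adj α)
              (≈-trans (adjoint-phase green α α†α αα† phase) (†-cong δ-morph))
              (†-cong ε-morph)

  id⇒morphism : (α : T 1 1) → α ≋ id 1 → IsBialgMorph G H α
  id⇒morphism α α≈id =
      (begin
        α ∘ μ red              ≈⟨ ∘-cong α≈id ≈-refl ⟩
        id 1 ∘ μ red           ≈⟨ idˡ ⟩
        μ red                  ≈⟨ ≈-sym idʳ ⟩
        μ red ∘ id 2           ≈⟨ ∘-cong ≈-refl id≈α⊗α ⟩
        μ red ∘ (α ⊗ α)        ∎)
    , ≈-trans (∘-cong α≈id ≈-refl) idˡ
    , (begin
        δ green ∘ α            ≈⟨ ∘-cong ≈-refl α≈id ⟩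
        δ green ∘ id 1         ≈⟨ idʳ ⟩
        δ green                ≈⟨ ≈-sym idˡ ⟩
        id 2 ∘ δ green         ≈⟨ ∘-cong id≈α⊗α ≈-refl ⟩
        (α ⊗ α) ∘ δ green      ∎)
    , ≈-trans (∘-cong ≈-refl α≈id) idʳ
    where
    id≈α⊗α : id 2 ≋ α ⊗ α
    id≈α⊗α = ≈-sym (≈-trans (⊗-cong α≈id α≈id) ⊗-id)

lemma10 : ∀ {a ℓa b ℓb} (G : AbelianGroup a ℓa) (H : AbelianGroup b ℓb)
    (c : Colour) (α : Term G H 1 1) → IsPhase G H c α →
    (IsBialgMorph G H α ⇔ _≈_ G H α (id 1))
lemma10 G H c α phase =
  mk⇔ (Proof.morphism⇒id G H c α phase) (Proof.id⇒morphism G H α)
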